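{- Let $X_1,\dots,X_t$ be $\{0,1\}$-valued random variables (not necessarily independent or identically distributed). Let $1\le k<t$, $T=\{k+1,\dots,t\}$, and suppose $\vec X=(X_1,\dots,X_k)$ and $\vec X'=(X_{k+1},\dots,X_t)$ are independent. For subsets $A_1,\dots,A_r\subseteq[t]$ define $\vec Y=(Y_1,\dots,Y_r)$ and $\vec Z=(Z_1,\dots,Z_r)$ by \[Y_j=\sum_{i\in A_j}X_i\pmod 2,\qquad Z_j=\sum_{i\in A_j\cap T}X_i\pmod 2\qquad (j=1,\dots,r),\] and let $W=\sum_{j=1}^rY_j\pmod 2$. Suppose $\vec Z$ is fix-parity $\varepsilon$-uniform and $\varepsilon<1/2$. Then $(\vec X\mid\vec Y)$ is $2\varepsilon$-close to $(\vec X\mid W)$; that is, for every $\vec y$ in the support of $\vec Y$, with $w=\sum_j y_j\pmod 2$, the conditional distribution $(\vec X\mid \vec Y=\vec y)$ is $2\varepsilon$-close to $(\vec X\mid W=w)$.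
   Context: A random variable $\vec V$ over $\{0,1\}^r$ is fix-parity uniform if there is $s\in\{0,1\}$ such that $\Pr[\vec V=(s_1,\dots,s_r)]=2^{ -(r-1)}$ when $s_1+\dots+s_r\equiv s\pmod 2$ and $0$ otherwise. $\vec V$ is fix-parity $\varepsilon$-uniform if it is $\varepsilon$-close to some fix-parity uniform distribution on $\{0,1\}^r$. For random variables $X,X'$ and events $\mathcal E,\mathcal E'$: $(X\mid\mathcal E)$ is $\varepsilon$-close to $(X'\mid\mathcal E')$ if they have the same support and for every $x$ in the support, $1-\varepsilon\le \Pr[X'=x\mid\mathcal E']/\Pr[X=x\mid \mathcal E]\le(1-\varepsilon)^{ -1}$ (with unconditioned versions defined analogously).
   Formalization: The joint distribution of $X_1,\dots,X_t$ takes rational values, and the parameter $\varepsilon$ is rational. -}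

module Defs where

open import Data.Nat as ℕ using (ℕ; zero; suc; _∸_)
open import Data.Bool using (Bool; true; false; _∧_; _xor_; if_then_else_)
open import Data.Bool.Properties using () renaming (_≟_ to _≟𝔹_)
open import Data.Fin using (Fin; toℕ)
open import Data.Fin.Subset using (Subset)
open import Data.Vec using (Vec; []; _∷_; tabulate; zipWith; foldr′; take; drop)
import Data.Vec as Vec
open import Data.Vec.Properties using (≡-dec)
open import Data.List using (List; []; _∷_; map; concatMap; foldr)
open import Data.Rational using (ℚ; 0ℚ; 1ℚ; ½; _+_; _*_; _-_; _≤_; _<_; 1/_; ≢-nonZero)
open import Data.Rational.Properties using (_≟_)
open import Data.Product using (_×_; Σ)
open import Relation.Nullary using (yes; no; does)
open import Relation.Binary.PropositionalEquality using (_≡_)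
open import Function.Bundles using (_⇔_)

allVecs : (n : ℕ) → List (Vec Bool n)
allVecs zero    = [] ∷ []
allVecs (suc n) = concatMap (λ v → (false ∷ v) ∷ (true ∷ v) ∷ []) (allVecs n)

sumℚ : List ℚ → ℚ
sumℚ = foldr _+_ 0ℚ

eqVec : ∀ {n} → Vec Bool n → Vec Bool n → Bool
eqVec u v = does (≡-dec _≟𝔹_ u v)

parity : ∀ {n} → Vec Bool n → Bool
parity = foldr′ _xor_ false

parityOn : ∀ {n} → Subset n → Vec Bool n → Bool
parityOn A ω = parity (zipWith _∧_ A ω)

-- Multiplicative inverse, with the convention 0⁻¹ = 0 (only used on nonzero values).
inv : ℚ → ℚ
inv q with q ≟ 0ℚ
... | yes _  = 0ℚ
... | no q≢0 = 1/_ q {{≢-nonZero q≢0}}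

halfPow : ℕ → ℚ
halfPow zero    = 1ℚ
halfPow (suc n) = ½ * halfPow n

-- A probability distribution on the sample space {0,1}^t (the joint law of X_1..X_t).
IsDist : ∀ {t} → (Vec Bool t → ℚ) → Set
IsDist {t} p = (∀ ω → 0ℚ ≤ p ω) × (sumℚ (map p (allVecs t)) ≡ 1ℚ)

Pr : ∀ {t} → (Vec Bool t → ℚ) → (Vec Bool t → Bool) → ℚ
Pr {t} p E = sumℚ (map (λ ω → if E ω then p ω else 0ℚ) (allVecs t))

law : ∀ {t n} → (Vec Bool t → ℚ) → (Vec Bool t → Vec Bool n) → Vec Bool n → ℚ
law p X x = Pr p (λ ω → eqVec (X ω) x)

condLaw : ∀ {t n} → (Vec Bool t → ℚ) → (Vec Bool t → Vec Bool n)
        → (Vec Bool t → Bool) → Vec Bool n → ℚ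
condLaw p X E x = Pr p (λ ω → eqVec (X ω) x ∧ E ω) * inv (Pr p E)

Independent : ∀ {t a b} → (Vec Bool t → ℚ)
            → (Vec Bool t → Vec Bool a) → (Vec Bool t → Vec Bool b) → Set
Independent p X X' = ∀ u v →
  Pr p (λ ω → eqVec (X ω) u ∧ eqVec (X' ω) v) ≡ law p X u * law p X' v

Close : ∀ {n} → ℚ → (Vec Bool n → ℚ) → (Vec Bool n → ℚ) → Set
Close ε P Q =
  (∀ x → (0ℚ < P x) ⇔ (0ℚ < Q x)) ×
  (∀ x → 0ℚ < P x →
     (1ℚ - ε ≤ Q x * inv (P x)) × (Q x * inv (P x) ≤ inv (1ℚ - ε)))

FixParityUniform : ∀ {r} → (Vec Bool r → ℚ) → Set
FixParityUniform {r} U =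
  Σ Bool λ s → ∀ v → U v ≡ (if does (parity v ≟𝔹 s) then halfPow (r ∸ 1) else 0ℚ)

FixParityεUniform : ∀ {r} → ℚ → (Vec Bool r → ℚ) → Set
FixParityεUniform {r} ε P = Σ (Vec Bool r → ℚ) λ U → FixParityUniform U × Close ε P U

-- T = {k+1,…,t} as a subset of [t] (0-based indices k,…,t-1).
upperSet : (k t : ℕ) → Subset t
upperSet k t = tabulate (λ i → k ℕ.≤ᵇ toℕ i)

parities : ∀ {t r} → Vec (Subset t) r → Vec Bool t → Vec Bool r
parities A ω = Vec.map (λ Aj → parityOn Aj ω) A

-- Split ω = (x, v) with x = take k ω and v = drop k ω.  Each Y_j is the parity of the x-part of A_j
-- xor that of its v-part, so Y = front x ⊕ Z with Z the function of v from the statement, and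
-- W = parity (front x) xor parity Z.  By independence of x and v,
--   Pr[X = x, Y = y] = Pr[X = x] · Pr[Z = front x ⊕ y],
--   Pr[X = x, W = w] = Pr[X = x] · Pr[parity Z = parity (front x) xor w].
-- Being ε-close to the uniform law on the vectors of some parity s, Z has parity s almost surely and
-- Pr[Z = z] is within a factor 1 - ε of 2^(1-r) · Pr[parity Z = parity z].  So the joint law of
-- (X, Y = y) is within that factor of 2^(1-r) times the joint law of (X, W = w), pointwise and hence
-- also in total mass; normalising both to conditional laws costs the factor once more, and
-- (1 - ε)² ≥ 1 - 2ε.

module Submission where

open import Defs
open import Algebra.Bundles using (CommutativeRing)
import Algebra.Properties.CommutativeSemigroup as CommutativeSemigroupProperties
open import Data.Nat as ℕ using (ℕ; zero; suc; _∸_) renaming (_+_ to _+ℕ_)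
open import Data.Bool using (Bool; true; false; _∧_; _xor_; not; if_then_else_)
open import Data.Bool.Properties
  using (∧-comm; ∧-zeroʳ; ∧-identityʳ; not-¬; xor-assoc; xor-same; xor-∧-commutativeRing)
  renaming (_≟_ to _≟𝔹_)
open import Data.Fin using (toℕ)
open import Data.Fin.Subset using (Subset; _∩_; ⊤)
open import Data.Fin.Subset.Properties using (∩-identityʳ)
open import Data.List using (List; []; _∷_; concatMap) renaming (map to mapL)
open import Data.Vec using (Vec; []; _∷_; take; drop; map; zipWith)
open import Data.Vec.Properties using (≡-dec; tabulate-cong)
open import Data.Rational
  using (ℚ; 0ℚ; 1ℚ; ½; _+_; _*_; _-_; -_; _≤_; _<_; ≢-nonZero; positive; nonNegative; nonPositive)
open import Data.Rational.Properties
  using ( _≟_; _<?_; +-*-commutativeRing; module ≤-Reasoning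
        ; +-assoc; +-identityˡ; +-identityʳ; +-inverseʳ; *-assoc; *-comm; *-identityʳ; *-zeroʳ
        ; *-distribˡ-+; *-inverseʳ
        ; ≤-refl; ≤-trans; ≤-reflexive; ≤-antisym; ≤-total; <⇒≤; <⇒≢; <-≤-trans; <-trans; ≮⇒≥
        ; +-mono-≤; +-monoʳ-≤; +-monoˡ-<; +-mono-<
        ; *-monoʳ-≤-nonNeg; *-monoˡ-≤-nonNeg; *-cancelˡ-≤-pos; *-cancelˡ-<-nonNeg
        ; positive⁻¹; nonNegative⁻¹; pos*pos⇒pos; nonNeg*nonNeg⇒nonNeg; nonPos*nonPos⇒nonPos; 1/pos⇒pos)
open import Data.Rational.Solver using (module +-*-Solver)
open import Data.Product using (_,_; proj₁; proj₂)
open import Data.Sum using (inj₁; inj₂)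
open import Function.Base using (_∘_)
open import Function.Bundles using (_⇔_; mk⇔; module Equivalence)
open import Data.Empty using (⊥-elim)
open import Relation.Nullary using (Dec; does; yes; no)
open import Relation.Nullary.Decidable using (does-⇔; does-≡; toWitness)
open import Relation.Binary.PropositionalEquality

open CommutativeSemigroupProperties
  (CommutativeRing.+-commutativeSemigroup xor-∧-commutativeRing)
  using () renaming (interchange to xor-interchange)
open CommutativeSemigroupProperties (CommutativeRing.*-commutativeSemigroup +-*-commutativeRing)
  using (x∙yz≈y∙xz)

infixl 6 _⊕_

_⊕_ : ∀ {n} → Vec Bool n → Vec Bool n → Vec Bool n
_⊕_ = zipWith _xor_

xor-cancelˡ : ∀ a b → a xor (a xor b) ≡ b
xor-cancelˡ a b = trans (sym (xor-assoc a a b)) (cong (_xor b) (xor-same a))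

⊕-cancelˡ : ∀ {n} (u w : Vec Bool n) → u ⊕ (u ⊕ w) ≡ w
⊕-cancelˡ []      []      = refl
⊕-cancelˡ (a ∷ u) (b ∷ w) = cong₂ _∷_ (xor-cancelˡ a b) (⊕-cancelˡ u w)

parity-⊕ : ∀ {n} (u w : Vec Bool n) → parity (u ⊕ w) ≡ parity u xor parity w
parity-⊕ []      []      = refl
parity-⊕ (a ∷ u) (b ∷ w) =
  trans (cong ((a xor b) xor_) (parity-⊕ u w)) (xor-interchange a b (parity u) (parity w))

eqVec-⊕ : ∀ {n} (u w y : Vec Bool n) → eqVec (u ⊕ w) y ≡ eqVec w (u ⊕ y)
eqVec-⊕ u w y = does-⇔ (mk⇔ to from) (≡-dec _≟𝔹_ (u ⊕ w) y) (≡-dec _≟𝔹_ w (u ⊕ y))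
  where
  to : u ⊕ w ≡ y → w ≡ u ⊕ y
  to refl = sym (⊕-cancelˡ u w)
  from : w ≡ u ⊕ y → u ⊕ w ≡ y
  from refl = ⊕-cancelˡ u y

xor-≟ : ∀ a b c → does ((a xor b) ≟𝔹 c) ≡ does (b ≟𝔹 (a xor c))
xor-≟ a b c = does-⇔ (mk⇔ to from) ((a xor b) ≟𝔹 c) (b ≟𝔹 (a xor c))
  where
  to : a xor b ≡ c → b ≡ a xor c
  to refl = sym (xor-cancelˡ a b)
  from : b ≡ a xor c → a xor b ≡ c
  from refl = xor-cancelˡ a c

not-≟ : ∀ a b → not (does (a ≟𝔹 b)) ≡ does (a ≟𝔹 not b)
not-≟ false false = refl
not-≟ false true  = refl
not-≟ true  false = refl
not-≟ true  true  = refl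

eqVec-∧-subst : ∀ {n} (F : Vec Bool n → Bool) (u v : Vec Bool n) →
  eqVec u v ∧ F u ≡ eqVec u v ∧ F v
eqVec-∧-subst F u v with ≡-dec _≟𝔹_ u v
... | yes refl = refl
... | no  _    = refl

parityOn-split : ∀ k {m} (A ω : Vec Bool (k +ℕ m)) →
  parityOn A ω ≡ parityOn (take k A) (take k ω) xor parityOn (drop k A) (drop k ω)
parityOn-split zero    A       ω       = refl
parityOn-split (suc k) (a ∷ A) (b ∷ ω) =
  trans (cong ((a ∧ b) xor_) (parityOn-split k A ω)) (sym (xor-assoc (a ∧ b) _ _))

upperSet-zero : ∀ m → upperSet 0 m ≡ ⊤
upperSet-zero zero    = refl
upperSet-zero (suc m) = cong (true ∷_) (upperSet-zero m)

upperSet-suc : ∀ k m → upperSet (suc k) (suc k +ℕ m) ≡ false ∷ upperSet k (k +ℕ m)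
upperSet-suc k m = cong (false ∷_) (tabulate-cong (λ i → ≤ᵇ-suc k (toℕ i)))
  where
  ≤ᵇ-suc : ∀ k n → (suc k ℕ.≤ᵇ suc n) ≡ (k ℕ.≤ᵇ n)
  ≤ᵇ-suc zero    n = refl
  ≤ᵇ-suc (suc k) n = refl

parityOn-∩-upperSet : ∀ k {m} (A ω : Vec Bool (k +ℕ m)) →
  parityOn (A ∩ upperSet k (k +ℕ m)) ω ≡ parityOn (drop k A) (drop k ω)
parityOn-∩-upperSet zero A ω =
  cong (λ B → parityOn B ω) (trans (cong (A ∩_) (upperSet-zero _)) (∩-identityʳ A))
parityOn-∩-upperSet (suc k) {m} (a ∷ A) (b ∷ ω) = begin
  parityOn ((a ∷ A) ∩ upperSet (suc k) (suc k +ℕ m)) (b ∷ ω)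
    ≡⟨ cong (λ U → parityOn ((a ∷ A) ∩ U) (b ∷ ω)) (upperSet-suc k m) ⟩
  ((a ∧ false) ∧ b) xor parityOn (A ∩ upperSet k (k +ℕ m)) ω
    ≡⟨ cong (λ c → (c ∧ b) xor parityOn (A ∩ upperSet k (k +ℕ m)) ω) (∧-zeroʳ a) ⟩
  parityOn (A ∩ upperSet k (k +ℕ m)) ω
    ≡⟨ parityOn-∩-upperSet k A ω ⟩
  parityOn (drop k A) (drop k ω) ∎
  where open ≡-Reasoning

parities-split : ∀ k {m r} (A : Vec (Subset (k +ℕ m)) r) (ω : Vec Bool (k +ℕ m)) →
  parities A ω ≡ parities (map (take k) A) (take k ω) ⊕ parities (map (drop k) A) (drop k ω)
parities-split k []       ω = refl
parities-split k (Aj ∷ A) ω = cong₂ _∷_ (parityOn-split k Aj ω) (parities-split k A ω)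

parities-∩-upperSet : ∀ k {m r} (A : Vec (Subset (k +ℕ m)) r) (ω : Vec Bool (k +ℕ m)) →
  parities (map (λ Aj → Aj ∩ upperSet k (k +ℕ m)) A) ω ≡ parities (map (drop k) A) (drop k ω)
parities-∩-upperSet k []       ω = refl
parities-∩-upperSet k (Aj ∷ A) ω = cong₂ _∷_ (parityOn-∩-upperSet k Aj ω) (parities-∩-upperSet k A ω)

module _ {a} {A : Set a} where

  sumℚ-cong : (L : List A) {f g : A → ℚ} → (∀ x → f x ≡ g x) →
    sumℚ (mapL f L) ≡ sumℚ (mapL g L)
  sumℚ-cong []      f≗g = refl
  sumℚ-cong (x ∷ L) f≗g = cong₂ _+_ (f≗g x) (sumℚ-cong L f≗g)

  sumℚ-zero : (L : List A) {f : A → ℚ} → (∀ x → f x ≡ 0ℚ) → sumℚ (mapL f L) ≡ 0ℚ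
  sumℚ-zero L f≗0 = trans (sumℚ-cong L f≗0) (sum-of-zeros L)
    where
    sum-of-zeros : (L : List A) → sumℚ (mapL (λ _ → 0ℚ) L) ≡ 0ℚ
    sum-of-zeros []      = refl
    sum-of-zeros (_ ∷ L) = trans (+-identityˡ _) (sum-of-zeros L)

  sumℚ-+ : (L : List A) (f g : A → ℚ) →
    sumℚ (mapL (λ x → f x + g x) L) ≡ sumℚ (mapL f L) + sumℚ (mapL g L)
  sumℚ-+ []      f g = refl
  sumℚ-+ (x ∷ L) f g = trans (cong ((f x + g x) +_) (sumℚ-+ L f g)) (swap (f x) (g x) _ _)
    where
    open +-*-Solver
    swap : ∀ a b c d → (a + b) + (c + d) ≡ (a + c) + (b + d)
    swap = solve 4 (λ a b c d → (a :+ b) :+ (c :+ d) := (a :+ c) :+ (b :+ d)) refl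

  sumℚ-*ˡ : (L : List A) (c : ℚ) (f : A → ℚ) →
    sumℚ (mapL (λ x → c * f x) L) ≡ c * sumℚ (mapL f L)
  sumℚ-*ˡ []      c f = sym (*-zeroʳ c)
  sumℚ-*ˡ (x ∷ L) c f =
    trans (cong ((c * f x) +_) (sumℚ-*ˡ L c f)) (sym (*-distribˡ-+ c (f x) _))

  sumℚ-mono-≤ : (L : List A) {f g : A → ℚ} → (∀ x → f x ≤ g x) →
    sumℚ (mapL f L) ≤ sumℚ (mapL g L)
  sumℚ-mono-≤ []      f≤g = ≤-refl
  sumℚ-mono-≤ (x ∷ L) f≤g = +-mono-≤ (f≤g x) (sumℚ-mono-≤ L f≤g)

  sumℚ-nonNeg : (L : List A) {f : A → ℚ} → (∀ x → 0ℚ ≤ f x) → 0ℚ ≤ sumℚ (mapL f L)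
  sumℚ-nonNeg []      f≥0 = ≤-refl
  sumℚ-nonNeg (x ∷ L) f≥0 = +-mono-≤ (f≥0 x) (sumℚ-nonNeg L f≥0)

sumℚ-comm : ∀ {a b} {A : Set a} {B : Set b} (L : List A) (M : List B) (f : A → B → ℚ) →
  sumℚ (mapL (λ x → sumℚ (mapL (f x) M)) L) ≡ sumℚ (mapL (λ y → sumℚ (mapL (λ x → f x y) L)) M)
sumℚ-comm []      M f = sym (sumℚ-zero M (λ _ → refl))
sumℚ-comm (x ∷ L) M f =
  trans (cong (sumℚ (mapL (f x) M) +_) (sumℚ-comm L M f))
        (sym (sumℚ-+ M (f x) (λ y → sumℚ (mapL (λ x → f x y) L))))

sumℚ-allVecs-suc : ∀ n (f : Vec Bool (suc n) → ℚ) →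
  sumℚ (mapL f (allVecs (suc n))) ≡ sumℚ (mapL (λ v → f (false ∷ v) + f (true ∷ v)) (allVecs n))
sumℚ-allVecs-suc n f = go (allVecs n)
  where
  go : (L : List (Vec Bool n)) →
    sumℚ (mapL f (concatMap (λ v → (false ∷ v) ∷ (true ∷ v) ∷ []) L))
      ≡ sumℚ (mapL (λ v → f (false ∷ v) + f (true ∷ v)) L)
  go []      = refl
  go (v ∷ L) = trans (sym (+-assoc (f (false ∷ v)) (f (true ∷ v)) _))
                     (cong ((f (false ∷ v) + f (true ∷ v)) +_) (go L))

sumℚ-allVecs-eqVec : ∀ n (w : Vec Bool n) (g : Vec Bool n → ℚ) →
  sumℚ (mapL (λ v → if eqVec w v then g v else 0ℚ) (allVecs n)) ≡ g w
sumℚ-allVecs-eqVec zero    []        g = +-identityʳ (g [])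
sumℚ-allVecs-eqVec (suc n) (false ∷ w) g =
  trans (sumℚ-allVecs-suc n _)
    (trans (sumℚ-cong (allVecs n) (λ v → +-identityʳ _)) (sumℚ-allVecs-eqVec n w (g ∘ (false ∷_))))
sumℚ-allVecs-eqVec (suc n) (true ∷ w) g =
  trans (sumℚ-allVecs-suc n _)
    (trans (sumℚ-cong (allVecs n) (λ v → +-identityˡ _)) (sumℚ-allVecs-eqVec n w (g ∘ (true ∷_))))

-- Probability on {0,1}^t

module _ {t : ℕ} (p : Vec Bool t → ℚ) where

  Pr-cong : {E F : Vec Bool t → Bool} → (∀ ω → E ω ≡ F ω) → Pr p E ≡ Pr p F
  Pr-cong E≗F = sumℚ-cong (allVecs t) (λ ω → cong (λ b → if b then p ω else 0ℚ) (E≗F ω))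

  Pr-nonNeg : IsDist p → (E : Vec Bool t → Bool) → 0ℚ ≤ Pr p E
  Pr-nonNeg (p≥0 , _) E = sumℚ-nonNeg (allVecs t) (λ ω → if-nonNeg (E ω) ω)
    where
    if-nonNeg : ∀ b ω → 0ℚ ≤ (if b then p ω else 0ℚ)
    if-nonNeg true  ω = p≥0 ω
    if-nonNeg false ω = ≤-refl

  Pr-complement : IsDist p → (E : Vec Bool t → Bool) → Pr p E + Pr p (not ∘ E) ≡ 1ℚ
  Pr-complement (_ , total) E =
    trans (sym (sumℚ-+ (allVecs t) _ _)) (trans (sumℚ-cong (allVecs t) (λ ω → split (E ω) ω)) total)
    where
    split : ∀ b ω → (if b then p ω else 0ℚ) + (if not b then p ω else 0ℚ) ≡ p ω
    split true  ω = +-identityʳ (p ω)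
    split false ω = +-identityˡ (p ω)

  Pr-const-∧ : (b : Bool) (E : Vec Bool t → Bool) →
    Pr p (λ ω → b ∧ E ω) ≡ (if b then Pr p E else 0ℚ)
  Pr-const-∧ true  E = refl
  Pr-const-∧ false E = sumℚ-zero (allVecs t) (λ _ → refl)

  Pr-total : ∀ {n} (V : Vec Bool t → Vec Bool n) (E : Vec Bool t → Bool) →
    Pr p E ≡ sumℚ (mapL (λ v → Pr p (λ ω → E ω ∧ eqVec (V ω) v)) (allVecs n))
  Pr-total {n} V E = sym (trans
    (sumℚ-comm (allVecs n) (allVecs t) (λ v ω → if E ω ∧ eqVec (V ω) v then p ω else 0ℚ))
    (sumℚ-cong (allVecs t) (λ ω → sum-over-v (E ω) ω)))
    where
    sum-over-v : ∀ b ω → sumℚ (mapL (λ v → if b ∧ eqVec (V ω) v then p ω else 0ℚ) (allVecs n))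
                       ≡ (if b then p ω else 0ℚ)
    sum-over-v true  ω = sumℚ-allVecs-eqVec n (V ω) (λ _ → p ω)
    sum-over-v false ω = sumℚ-zero (allVecs n) (λ _ → refl)

  Pr-∧-∘ : ∀ {n} (V : Vec Bool t → Vec Bool n) (E : Vec Bool t → Bool) (H : Vec Bool n → Bool) →
    Pr p (λ ω → E ω ∧ H (V ω))
      ≡ sumℚ (mapL (λ v → if H v then Pr p (λ ω → E ω ∧ eqVec (V ω) v) else 0ℚ) (allVecs n))
  Pr-∧-∘ {n} V E H = trans (Pr-total V _) (sumℚ-cong (allVecs n) (λ v →
    trans (Pr-cong (λ ω → ∧-eqVec-swap (E ω) (V ω) v)) (Pr-const-∧ (H v) _)))
    where
    ∧-eqVec-swap : ∀ e u v → (e ∧ H u) ∧ eqVec u v ≡ H v ∧ (e ∧ eqVec u v)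
    ∧-eqVec-swap e u v with ≡-dec _≟𝔹_ u v
    ... | yes refl = trans (∧-identityʳ _) (trans (∧-comm e (H u)) (cong (H u ∧_) (sym (∧-identityʳ e))))
    ... | no  _    = trans (∧-zeroʳ _) (sym (trans (cong (H v ∧_) (∧-zeroʳ e)) (∧-zeroʳ (H v))))

  Pr-∘ : ∀ {n} (V : Vec Bool t → Vec Bool n) (H : Vec Bool n → Bool) →
    Pr p (H ∘ V) ≡ sumℚ (mapL (λ v → if H v then law p V v else 0ℚ) (allVecs n))
  Pr-∘ V = Pr-∧-∘ V (λ _ → true)

  Pr-independent : ∀ {a n} {X : Vec Bool t → Vec Bool a} {V : Vec Bool t → Vec Bool n} →
    Independent p X V → (x : Vec Bool a) (F : Vec Bool a → Vec Bool n → Bool) →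
    Pr p (λ ω → eqVec (X ω) x ∧ F (X ω) (V ω)) ≡ law p X x * Pr p (F x ∘ V)
  Pr-independent {n = n} {X} {V} indep x F = begin
    Pr p (λ ω → eqVec (X ω) x ∧ F (X ω) (V ω))
      ≡⟨ Pr-cong (λ ω → eqVec-∧-subst (λ u → F u (V ω)) (X ω) x) ⟩
    Pr p (λ ω → eqVec (X ω) x ∧ H (V ω))
      ≡⟨ Pr-∧-∘ V (λ ω → eqVec (X ω) x) H ⟩
    sumℚ (mapL (λ v → if H v then Pr p (λ ω → eqVec (X ω) x ∧ eqVec (V ω) v) else 0ℚ) (allVecs n))
      ≡⟨ sumℚ-cong (allVecs n) (λ v → trans (cong (λ q → if H v then q else 0ℚ) (indep x v))
                                              (if-*ˡ (H v) (law p X x) (law p V v))) ⟩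
    sumℚ (mapL (λ v → law p X x * (if H v then law p V v else 0ℚ)) (allVecs n))
      ≡⟨ sumℚ-*ˡ (allVecs n) (law p X x) _ ⟩
    law p X x * sumℚ (mapL (λ v → if H v then law p V v else 0ℚ) (allVecs n))
      ≡⟨ cong (law p X x *_) (sym (Pr-∘ V H)) ⟩
    law p X x * Pr p (H ∘ V) ∎
    where
    open ≡-Reasoning
    H : Vec Bool n → Bool
    H = F x
    if-*ˡ : ∀ b c q → (if b then c * q else 0ℚ) ≡ c * (if b then q else 0ℚ)
    if-*ˡ true  c q = refl
    if-*ˡ false c q = sym (*-zeroʳ c)

inv-inverseʳ : ∀ {d} → 0ℚ < d → d * inv d ≡ 1ℚ
inv-inverseʳ {d} 0<d with d ≟ 0ℚ
... | yes d≡0 = ⊥-elim (<⇒≢ 0<d (sym d≡0))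
... | no  d≢0 = *-inverseʳ d {{≢-nonZero d≢0}}

inv-pos : ∀ {d} → 0ℚ < d → 0ℚ < inv d
inv-pos {d} 0<d with d ≟ 0ℚ
... | yes d≡0 = ⊥-elim (<⇒≢ 0<d (sym d≡0))
... | no  d≢0 = positive⁻¹ _ {{1/pos⇒pos d {{positive 0<d}}}}

inv-nonNeg : ∀ {d} → 0ℚ ≤ d → 0ℚ ≤ inv d
inv-nonNeg {d} 0≤d with 0ℚ <? d
... | yes 0<d = <⇒≤ (inv-pos 0<d)
... | no  d≯0 = subst (λ d → 0ℚ ≤ inv d) (sym (≤-antisym (≮⇒≥ d≯0) 0≤d)) ≤-refl

*-pos : ∀ {a b} → 0ℚ < a → 0ℚ < b → 0ℚ < a * b
*-pos {a} {b} 0<a 0<b = positive⁻¹ (a * b) {{pos*pos⇒pos a {{positive 0<a}} b {{positive 0<b}}}}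

*-nonNeg : ∀ {a b} → 0ℚ ≤ a → 0ℚ ≤ b → 0ℚ ≤ a * b
*-nonNeg {a} {b} 0≤a 0≤b =
  nonNegative⁻¹ (a * b) {{nonNeg*nonNeg⇒nonNeg a {{nonNegative 0≤a}} b {{nonNegative 0≤b}}}}

*-inv-cancelʳ : ∀ a {b} → 0ℚ < b → a * inv b * b ≡ a
*-inv-cancelʳ a {b} 0<b = begin
  a * inv b * b   ≡⟨ *-assoc a (inv b) b ⟩
  a * (inv b * b) ≡⟨ cong (a *_) (trans (*-comm (inv b) b) (inv-inverseʳ 0<b)) ⟩
  a * 1ℚ          ≡⟨ *-identityʳ a ⟩
  a               ∎
  where open ≡-Reasoning

*-*-inv-cancelʳ : ∀ a {b} → 0ℚ < b → a * b * inv b ≡ a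
*-*-inv-cancelʳ a {b} 0<b =
  trans (*-assoc a b (inv b)) (trans (cong (a *_) (inv-inverseʳ 0<b)) (*-identityʳ a))

ratio-≤⇔ : ∀ {a b c} → 0ℚ < b → (a * inv b ≤ c) ⇔ (a ≤ c * b)
ratio-≤⇔ {a} {b} {c} 0<b = mk⇔
  (λ h → subst (_≤ c * b) (*-inv-cancelʳ a 0<b) (*-monoʳ-≤-nonNeg b {{nonNegative (<⇒≤ 0<b)}} h))
  (λ h → subst (a * inv b ≤_) (*-*-inv-cancelʳ c 0<b)
           (*-monoʳ-≤-nonNeg (inv b) {{nonNegative (<⇒≤ (inv-pos 0<b))}} h))

≤-ratio⇔ : ∀ {a b c} → 0ℚ < b → (c ≤ a * inv b) ⇔ (c * b ≤ a)
≤-ratio⇔ {a} {b} {c} 0<b = mk⇔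
  (λ h → subst (c * b ≤_) (*-inv-cancelʳ a 0<b) (*-monoʳ-≤-nonNeg b {{nonNegative (<⇒≤ 0<b)}} h))
  (λ h → subst (_≤ a * inv b) (*-*-inv-cancelʳ c 0<b)
           (*-monoʳ-≤-nonNeg (inv b) {{nonNegative (<⇒≤ (inv-pos 0<b))}} h))

≤-inv-*⇔ : ∀ {a b e} → 0ℚ < e → (a ≤ inv e * b) ⇔ (e * a ≤ b)
≤-inv-*⇔ {a} {b} {e} 0<e = mk⇔
  (λ h → subst (_≤ b) (*-comm a e) (to (subst (a ≤_) (*-comm (inv e) b) h)))
  (λ h → subst (a ≤_) (*-comm b (inv e)) (from (subst (_≤ b) (*-comm e a) h)))
  where open Equivalence (≤-ratio⇔ {b} {e} {a} 0<e)

sub-pos : ∀ {a b} → a < b → 0ℚ < b - a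
sub-pos {a} {b} a<b = subst (_< b - a) (+-inverseʳ a) (+-monoˡ-< (- a) a<b)

square-nonNeg : ∀ a → 0ℚ ≤ a * a
square-nonNeg a with ≤-total 0ℚ a
... | inj₁ 0≤a = *-nonNeg 0≤a 0≤a
... | inj₂ a≤0 =
  nonNegative⁻¹ (a * a) {{nonPos*nonPos⇒nonPos a {{nonPositive a≤0}} a {{nonPositive a≤0}}}}

1-2ε≤[1-ε]² : ∀ ε → 1ℚ - (ε + ε) ≤ (1ℚ - ε) * (1ℚ - ε)
1-2ε≤[1-ε]² ε = begin
  1ℚ - (ε + ε)             ≡⟨ sym (+-identityʳ _) ⟩
  1ℚ - (ε + ε) + 0ℚ        ≤⟨ +-monoʳ-≤ (1ℚ - (ε + ε)) (square-nonNeg ε) ⟩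
  1ℚ - (ε + ε) + ε * ε     ≡⟨ solve 1 (λ ε → con 1ℚ :- (ε :+ ε) :+ ε :* ε
                                            := (con 1ℚ :- ε) :* (con 1ℚ :- ε)) refl ε ⟩
  (1ℚ - ε) * (1ℚ - ε)      ∎
  where
  open ≤-Reasoning
  open +-*-Solver

-- Agreement up to a constant factor

record WithinFactor (e a b : ℚ) : Set where
  constructor mkWithin
  field
    e*a≤b : e * a ≤ b
    e*b≤a : e * b ≤ a

within-sym : ∀ {e a b} → WithinFactor e a b → WithinFactor e b a
within-sym (mkWithin ea≤b eb≤a) = mkWithin eb≤a ea≤b

within-*ʳ : ∀ {e a b} c → 0ℚ ≤ c → WithinFactor e a b → WithinFactor e (a * c) (b * c)
within-*ʳ {e} c 0≤c (mkWithin ea≤b eb≤a) = mkWithin (scale ea≤b) (scale eb≤a)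
  where
  scale : ∀ {a b} → e * a ≤ b → e * (a * c) ≤ b * c
  scale {a} h = subst (_≤ _) (*-assoc e a c) (*-monoʳ-≤-nonNeg c {{nonNegative 0≤c}} h)

within-*ˡ : ∀ {e a b} c → 0ℚ ≤ c → WithinFactor e a b → WithinFactor e (c * a) (c * b)
within-*ˡ {e} {a} {b} c 0≤c w =
  subst₂ (WithinFactor e) (*-comm a c) (*-comm b c) (within-*ʳ {e} c 0≤c w)

within-trans : ∀ {e e′ a b c} → 0ℚ ≤ e → 0ℚ ≤ e′ →
  WithinFactor e a b → WithinFactor e′ b c → WithinFactor (e * e′) a c
within-trans {e} {e′} {a} {b} {c} 0≤e 0≤e′ (mkWithin ea≤b eb≤a) (mkWithin e′b≤c e′c≤b) =
  mkWithin
  (begin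
    e * e′ * a   ≡⟨ cong (_* a) (*-comm e e′) ⟩
    e′ * e * a   ≡⟨ *-assoc e′ e a ⟩
    e′ * (e * a) ≤⟨ *-monoˡ-≤-nonNeg e′ {{nonNegative 0≤e′}} ea≤b ⟩
    e′ * b       ≤⟨ e′b≤c ⟩
    c            ∎)
  (begin
    e * e′ * c   ≡⟨ *-assoc e e′ c ⟩
    e * (e′ * c) ≤⟨ *-monoˡ-≤-nonNeg e {{nonNegative 0≤e}} e′c≤b ⟩
    e * b        ≤⟨ eb≤a ⟩
    a            ∎)
  where open ≤-Reasoning

within-mono : ∀ {e e′ a b} → e′ ≤ e → 0ℚ ≤ a → 0ℚ ≤ b →
  WithinFactor e a b → WithinFactor e′ a b
within-mono e′≤e 0≤a 0≤b (mkWithin ea≤b eb≤a) = mkWithin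
  (≤-trans (*-monoʳ-≤-nonNeg _ {{nonNegative 0≤a}} e′≤e) ea≤b)
  (≤-trans (*-monoʳ-≤-nonNeg _ {{nonNegative 0≤b}} e′≤e) eb≤a)

within-pos : ∀ {e a b} → 0ℚ < e → 0ℚ < a → WithinFactor e a b → 0ℚ < b
within-pos 0<e 0<a (mkWithin ea≤b _) = <-≤-trans (*-pos 0<e 0<a) ea≤b

within-zero : ∀ {e a} → 0ℚ < e → 0ℚ ≤ a → WithinFactor e a 0ℚ → a ≡ 0ℚ
within-zero {e} {a} 0<e 0≤a (mkWithin ea≤0 _) =
  ≤-antisym (*-cancelˡ-≤-pos e {{positive 0<e}} (subst (e * a ≤_) (sym (*-zeroʳ e)) ea≤0)) 0≤a

within-sumℚ : ∀ {a} {A : Set a} (L : List A) {e : ℚ} {f g : A → ℚ} →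
  (∀ x → WithinFactor e (f x) (g x)) →
  WithinFactor e (sumℚ (mapL f L)) (sumℚ (mapL g L))
within-sumℚ L {e} {f} {g} f≈g =
  mkWithin (bound f g (WithinFactor.e*a≤b ∘ f≈g)) (bound g f (WithinFactor.e*b≤a ∘ f≈g))
  where
  bound : (f g : _ → ℚ) → (∀ x → e * f x ≤ g x) → e * sumℚ (mapL f L) ≤ sumℚ (mapL g L)
  bound f g ef≤g = subst (_≤ _) (sumℚ-*ˡ L e f) (sumℚ-mono-≤ L ef≤g)

close⇒within : ∀ {n} {ε : ℚ} {P Q : Vec Bool n → ℚ} → 0ℚ < 1ℚ - ε →
  (∀ x → 0ℚ ≤ P x) → (∀ x → 0ℚ ≤ Q x) →
  Close ε P Q → ∀ x → WithinFactor (1ℚ - ε) (P x) (Q x)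
close⇒within {ε = ε} {P} {Q} 0<1-ε P≥0 Q≥0 (same-support , ratio) x with 0ℚ <? P x
... | yes 0<Px = mkWithin
  (Equivalence.to (≤-ratio⇔ 0<Px) (proj₁ (ratio x 0<Px)))
  (Equivalence.to (≤-inv-*⇔ 0<1-ε)
    (Equivalence.to (ratio-≤⇔ 0<Px) (proj₂ (ratio x 0<Px))))
... | no  Px≯0 = subst₂ (WithinFactor (1ℚ - ε)) (sym Px≡0) (sym Qx≡0) (mkWithin zero≈zero zero≈zero)
  where
  Px≡0 : P x ≡ 0ℚ
  Px≡0 = ≤-antisym (≮⇒≥ Px≯0) (P≥0 x)
  Qx≡0 : Q x ≡ 0ℚ
  Qx≡0 = ≤-antisym (≮⇒≥ (Px≯0 ∘ Equivalence.from (same-support x))) (Q≥0 x)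
  zero≈zero : (1ℚ - ε) * 0ℚ ≤ 0ℚ
  zero≈zero = ≤-reflexive (*-zeroʳ (1ℚ - ε))

within⇒close : ∀ {n} {δ : ℚ} {P Q : Vec Bool n → ℚ} → 0ℚ < 1ℚ - δ →
  (∀ x → WithinFactor (1ℚ - δ) (P x) (Q x)) → Close δ P Q
within⇒close 0<1-δ P≈Q =
  (λ x → mk⇔ (λ 0<Px → within-pos 0<1-δ 0<Px (P≈Q x))
             (λ 0<Qx → within-pos 0<1-δ 0<Qx (within-sym (P≈Q x)))) ,
  (λ x 0<Px → Equivalence.from (≤-ratio⇔ 0<Px) (WithinFactor.e*a≤b (P≈Q x)) ,
              Equivalence.from (ratio-≤⇔ 0<Px)
                (Equivalence.from (≤-inv-*⇔ 0<1-δ) (WithinFactor.e*b≤a (P≈Q x))))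

within-normalise : ∀ {a} {A : Set a} (L : List A) {f g : A → ℚ} {e c : ℚ} →
  0ℚ < e → 0ℚ < c → (∀ x → 0ℚ ≤ g x) →
  (∀ x → WithinFactor e (f x) (c * g x)) → 0ℚ < sumℚ (mapL f L) →
  ∀ x → WithinFactor (e * e) (f x * inv (sumℚ (mapL f L))) (g x * inv (sumℚ (mapL g L)))
within-normalise L {f} {g} {e} {c} 0<e 0<c g≥0 f≈cg 0<F x =
  within-trans (<⇒≤ 0<e) (<⇒≤ 0<e)
    (within-*ʳ (inv F) (<⇒≤ (inv-pos 0<F)) (f≈cg x))
    (subst₂ (WithinFactor e) cancel-G cancel-F
      (within-*ʳ (g x * inv F * inv G) 0≤gx/FG (within-sym F≈cG)))
  where
  open +-*-Solver
  F G : ℚ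
  F = sumℚ (mapL f L)
  G = sumℚ (mapL g L)
  F≈cG : WithinFactor e F (c * G)
  F≈cG = subst (WithinFactor e F) (sumℚ-*ˡ L c g) (within-sumℚ L f≈cg)
  0<G : 0ℚ < G
  0<G = *-cancelˡ-<-nonNeg c {{nonNegative (<⇒≤ 0<c)}}
          (subst (_< c * G) (sym (*-zeroʳ c)) (within-pos 0<e 0<F F≈cG))
  0≤gx/FG : 0ℚ ≤ g x * inv F * inv G
  0≤gx/FG = *-nonNeg (*-nonNeg (g≥0 x) (<⇒≤ (inv-pos 0<F))) (<⇒≤ (inv-pos 0<G))
  cancel-G : c * G * (g x * inv F * inv G) ≡ c * g x * inv F
  cancel-G = begin
    c * G * (g x * inv F * inv G) ≡⟨ solve 5 (λ c G g i j → c :* G :* (g :* i :* j)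
                                                    := c :* g :* i :* (G :* j))
                                       refl c G (g x) (inv F) (inv G) ⟩
    c * g x * inv F * (G * inv G) ≡⟨ cong (c * g x * inv F *_) (inv-inverseʳ 0<G) ⟩
    c * g x * inv F * 1ℚ          ≡⟨ *-identityʳ _ ⟩
    c * g x * inv F               ∎
    where open ≡-Reasoning
  cancel-F : F * (g x * inv F * inv G) ≡ g x * inv G
  cancel-F = begin
    F * (g x * inv F * inv G) ≡⟨ solve 4 (λ F g i j → F :* (g :* i :* j) := g :* j :* (F :* i))
                                   refl F (g x) (inv F) (inv G) ⟩
    g x * inv G * (F * inv F) ≡⟨ cong (g x * inv G *_) (inv-inverseʳ 0<F) ⟩
    g x * inv G * 1ℚ          ≡⟨ *-identityʳ _ ⟩
    g x * inv G               ∎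
    where open ≡-Reasoning

module _ {t : ℕ} {p : Vec Bool t → ℚ} (dist : IsDist p) where

  condLaw-nonNeg : ∀ {n} (X : Vec Bool t → Vec Bool n) E x → 0ℚ ≤ condLaw p X E x
  condLaw-nonNeg X E x = *-nonNeg (Pr-nonNeg p dist _) (inv-nonNeg (Pr-nonNeg p dist E))

  Pr≡sum-joint : ∀ {n} (X : Vec Bool t → Vec Bool n) E →
    Pr p E ≡ sumℚ (mapL (λ x → Pr p (λ ω → eqVec (X ω) x ∧ E ω)) (allVecs n))
  Pr≡sum-joint {n} X E =
    trans (Pr-total p X E) (sumℚ-cong (allVecs n) (λ x → Pr-cong p (λ ω → ∧-comm (E ω) _)))

  condLaw-within : ∀ {n} (X : Vec Bool t → Vec Bool n) {E F : Vec Bool t → Bool} {e c : ℚ} →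
    0ℚ < e → 0ℚ < c → 0ℚ < Pr p E →
    (∀ x → WithinFactor e (Pr p (λ ω → eqVec (X ω) x ∧ E ω))
                          (c * Pr p (λ ω → eqVec (X ω) x ∧ F ω))) →
    ∀ x → WithinFactor (e * e) (condLaw p X E x) (condLaw p X F x)
  condLaw-within {n} X {E} {F} 0<e 0<c 0<PrE joint≈ x =
    subst₂ (WithinFactor _) (normalised-by E) (normalised-by F)
      (within-normalise (allVecs n) 0<e 0<c (λ _ → Pr-nonNeg p dist _) joint≈
        (subst (0ℚ <_) (Pr≡sum-joint X E) 0<PrE) x)
    where
    joint : (Vec Bool t → Bool) → Vec Bool n → ℚ
    joint G x = Pr p (λ ω → eqVec (X ω) x ∧ G ω)
    normalised-by : ∀ G → joint G x * inv (sumℚ (mapL (joint G) (allVecs n))) ≡ condLaw p X G x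
    normalised-by G = cong (λ P → joint G x * inv P) (sym (Pr≡sum-joint X G))

parityLaw : ∀ {t r} → (Vec Bool t → ℚ) → (Vec Bool t → Vec Bool r) → Bool → ℚ
parityLaw p Z β = Pr p (λ ω → does (parity (Z ω) ≟𝔹 β))

halfPow-pos : ∀ n → 0ℚ < halfPow n
halfPow-pos zero    = positive⁻¹ 1ℚ
halfPow-pos (suc n) = *-pos (positive⁻¹ ½) (halfPow-pos n)

module _ {t r : ℕ} {p : Vec Bool t → ℚ} {Z : Vec Bool t → Vec Bool r} {s : Bool}
         (supported : ∀ z → parity z ≢ s → law p Z z ≡ 0ℚ) where

  parityLaw-≢ : ∀ β → β ≢ s → parityLaw p Z β ≡ 0ℚ
  parityLaw-≢ β β≢s = trans (Pr-∘ p Z (λ z → does (parity z ≟𝔹 β)))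
    (sumℚ-zero (allVecs r) (λ z → term z (parity z ≟𝔹 β)))
    where
    term : ∀ z → (d : Dec (parity z ≡ β)) → (if does d then law p Z z else 0ℚ) ≡ 0ℚ
    term z (yes refl) = supported z β≢s
    term z (no _)     = refl

  parityLaw-≡ : IsDist p → parityLaw p Z s ≡ 1ℚ
  parityLaw-≡ dist = begin
    parityLaw p Z s
      ≡⟨ sym (+-identityʳ _) ⟩
    parityLaw p Z s + 0ℚ
      ≡⟨ cong (parityLaw p Z s +_) (sym Pr-not≡0) ⟩
    parityLaw p Z s + Pr p (λ ω → not (does (parity (Z ω) ≟𝔹 s)))
      ≡⟨ Pr-complement p dist _ ⟩
    1ℚ ∎
    where
    open ≡-Reasoning
    Pr-not≡0 : Pr p (λ ω → not (does (parity (Z ω) ≟𝔹 s))) ≡ 0ℚ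
    Pr-not≡0 = trans (Pr-cong p (λ ω → not-≟ (parity (Z ω)) s))
                     (parityLaw-≢ (not s) (λ not-s≡s → not-¬ refl (sym not-s≡s)))

fixParityεUniform⇒within : ∀ {t r} {p : Vec Bool t → ℚ} {Z : Vec Bool t → Vec Bool r} {ε : ℚ} →
  IsDist p → 0ℚ < 1ℚ - ε → FixParityεUniform ε (law p Z) →
  ∀ z → WithinFactor (1ℚ - ε) (law p Z z) (halfPow (r ∸ 1) * parityLaw p Z (parity z))
fixParityεUniform⇒within {t} {r} {p} {Z} {ε} dist 0<1-ε (U , (s , U≡) , Z≈U) z =
  subst (WithinFactor (1ℚ - ε) (law p Z z)) (U≡c*parityLaw (parity z ≟𝔹 s)) (law≈U z)
  where
  c : ℚ
  c = halfPow (r ∸ 1)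
  U-if : ∀ z → (d : Dec (parity z ≡ s)) → U z ≡ (if does d then c else 0ℚ)
  U-if z d = trans (U≡ z) (cong (λ b → if b then c else 0ℚ) (does-≡ (parity z ≟𝔹 s) d))
  U-nonNeg : ∀ z → 0ℚ ≤ U z
  U-nonNeg z with parity z ≟𝔹 s
  ... | yes e = subst (0ℚ ≤_) (sym (U-if z (yes e))) (<⇒≤ (halfPow-pos (r ∸ 1)))
  ... | no ne = ≤-reflexive (sym (U-if z (no ne)))
  law≈U : ∀ z → WithinFactor (1ℚ - ε) (law p Z z) (U z)
  law≈U = close⇒within {ε = ε} 0<1-ε (λ _ → Pr-nonNeg p dist _) U-nonNeg Z≈U
  supported : ∀ z → parity z ≢ s → law p Z z ≡ 0ℚ
  supported z ne =
    within-zero 0<1-ε (Pr-nonNeg p dist _) (subst (WithinFactor _ _) (U-if z (no ne)) (law≈U z))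
  U≡c*parityLaw : (d : Dec (parity z ≡ s)) → U z ≡ c * parityLaw p Z (parity z)
  U≡c*parityLaw d@(yes refl) =
    trans (U-if z d)
      (sym (trans (cong (c *_) (parityLaw-≡ {p = p} {Z} supported dist)) (*-identityʳ c)))
  U≡c*parityLaw d@(no ne) =
    trans (U-if z d)
      (sym (trans (cong (c *_) (parityLaw-≢ {p = p} {Z} supported (parity z) ne)) (*-zeroʳ c)))

-- Splitting the sample space after the first k coordinates

module SplitAt {k m r : ℕ} {p : Vec Bool (k +ℕ m) → ℚ} (indep : Independent p (take k) (drop k))
               (A : Vec (Subset (k +ℕ m)) r) where

  front : Vec Bool k → Vec Bool r
  front = parities (map (take k) A)

  back : Vec Bool m → Vec Bool r
  back = parities (map (drop k) A)

  Z : Vec Bool (k +ℕ m) → Vec Bool r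
  Z = parities (map (λ Aj → Aj ∩ upperSet k (k +ℕ m)) A)

  joint-law-parities : ∀ x y →
    Pr p (λ ω → eqVec (take k ω) x ∧ eqVec (parities A ω) y)
      ≡ law p (take k) x * law p Z (front x ⊕ y)
  joint-law-parities x y = begin
    Pr p (λ ω → eqVec (take k ω) x ∧ eqVec (parities A ω) y)
      ≡⟨ Pr-cong p (λ ω → cong (eqVec (take k ω) x ∧_) (trans
           (cong (λ u → eqVec u y) (parities-split k A ω))
           (eqVec-⊕ (front (take k ω)) (back (drop k ω)) y))) ⟩
    Pr p (λ ω → eqVec (take k ω) x ∧ eqVec (back (drop k ω)) (front (take k ω) ⊕ y))
      ≡⟨ Pr-independent p indep x (λ u v → eqVec (back v) (front u ⊕ y)) ⟩
    law p (take k) x * Pr p (λ ω → eqVec (back (drop k ω)) (front x ⊕ y))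
      ≡⟨ cong (law p (take k) x *_) (Pr-cong p (λ ω →
           cong (λ u → eqVec u (front x ⊕ y)) (sym (parities-∩-upperSet k A ω)))) ⟩
    law p (take k) x * law p Z (front x ⊕ y) ∎
    where open ≡-Reasoning

  joint-law-parity : ∀ x w →
    Pr p (λ ω → eqVec (take k ω) x ∧ does (parity (parities A ω) ≟𝔹 w))
      ≡ law p (take k) x * parityLaw p Z (parity (front x) xor w)
  joint-law-parity x w = begin
    Pr p (λ ω → eqVec (take k ω) x ∧ does (parity (parities A ω) ≟𝔹 w))
      ≡⟨ Pr-cong p (λ ω → cong (eqVec (take k ω) x ∧_) (trans
           (cong (λ u → does (u ≟𝔹 w)) (trans (cong parity (parities-split k A ω))
                                            (parity-⊕ (front (take k ω)) (back (drop k ω)))))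
           (xor-≟ (parity (front (take k ω))) (parity (back (drop k ω))) w))) ⟩
    Pr p (λ ω → eqVec (take k ω) x ∧ does (parity (back (drop k ω)) ≟𝔹 parity (front (take k ω)) xor w))
      ≡⟨ Pr-independent p indep x (λ u v → does (parity (back v) ≟𝔹 parity (front u) xor w)) ⟩
    law p (take k) x * Pr p (λ ω → does (parity (back (drop k ω)) ≟𝔹 parity (front x) xor w))
      ≡⟨ cong (law p (take k) x *_) (Pr-cong p (λ ω →
           cong (λ u → does (parity u ≟𝔹 parity (front x) xor w)) (sym (parities-∩-upperSet k A ω)))) ⟩
    law p (take k) x * parityLaw p Z (parity (front x) xor w) ∎
    where open ≡-Reasoning

lemma3p14 : (k m r : ℕ) → 1 ℕ.≤ k → 1 ℕ.≤ m
    → (p : Vec Bool (k +ℕ m) → ℚ) → IsDist p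
    → Independent p (take k) (drop k)
    → (A : Vec (Subset (k +ℕ m)) r)
    → (ε : ℚ) → ε < ½
    → FixParityεUniform ε (law p (parities (map (λ Aj → Aj ∩ upperSet k (k +ℕ m)) A)))
    → (y : Vec Bool r) → 0ℚ < law p (parities A) y
    → Close (ε + ε)
        (condLaw p (take k) (λ ω → eqVec (parities A ω) y))
        (condLaw p (take k) (λ ω → does (parity (parities A ω) ≟𝔹 parity y)))
lemma3p14 k m r _ _ p dist indep A ε ε<½ Z-uniform y 0<PrY =
  within⇒close {δ = ε + ε} (sub-pos (+-mono-< ε<½ ε<½)) λ x →
    within-mono (1-2ε≤[1-ε]² ε) (condLaw-nonNeg dist (take k) Y≡y x)
                                  (condLaw-nonNeg dist (take k) W≡w x)
      (condLaw-within dist (take k) 0<1-ε (halfPow-pos (r ∸ 1)) 0<PrY joint≈ x)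
  where
  open SplitAt indep A
  Y≡y W≡w : Vec Bool (k +ℕ m) → Bool
  Y≡y ω = eqVec (parities A ω) y
  W≡w ω = does (parity (parities A ω) ≟𝔹 parity y)
  c : ℚ
  c = halfPow (r ∸ 1)
  0<1-ε : 0ℚ < 1ℚ - ε
  0<1-ε = sub-pos (<-trans ε<½ (toWitness {a? = ½ <? 1ℚ} _))
  joint≈ : ∀ x → WithinFactor (1ℚ - ε)
    (Pr p (λ ω → eqVec (take k ω) x ∧ Y≡y ω)) (c * Pr p (λ ω → eqVec (take k ω) x ∧ W≡w ω))
  joint≈ x = subst₂ (WithinFactor (1ℚ - ε)) (sym (joint-law-parities x y))
    (trans (x∙yz≈y∙xz (law p (take k) x) c _) (cong (c *_) (sym (joint-law-parity x (parity y)))))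
    (within-*ˡ (law p (take k) x) (Pr-nonNeg p dist _)
      (subst (λ β → WithinFactor (1ℚ - ε) (law p Z (front x ⊕ y)) (c * parityLaw p Z β))
        (parity-⊕ (front x) y)
        (fixParityεUniform⇒within {Z = Z} {ε = ε} dist 0<1-ε Z-uniform (front x ⊕ y))))
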